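{- Let $\Delta$ be a centrally symmetric simplicial complex with free involution $\sigma$, and let $\ell$ be a locally acyclic orientation of $\Delta$ such that the refinement $(\Delta\times[-1,1])^{\ell}$ is centrally symmetric with free involution induced by $\widetilde\sigma:(v,-1)\mapsto(\sigma(v),1)$, $(v,1)\mapsto(\sigma(v),-1)$ for every vertex $v$ of $\Delta$. Then $\ell$ is order reversing with respect to the symmetry: for every edge $\{v,w\}$ of $\Delta$, $v\to w$ if and only if $\sigma(w)\to\sigma(v)$.
   Context: A simplicial complex is centrally symmetric if its vertex set carries a free involution mapping faces to faces and inducing a free involution on non-empty faces. A locally acyclic orientation (l.a.o.) of $\Delta$ is an orientation of the edges of its graph such that no $2$-simplex contains an oriented cycle. Given an l.a.o. $\ell$, $(\Delta\times[-1,1])^{\ell}$ is the simplicial complex on $V(\Delta)\times\{ -1,1\}$ whose edges are $\{(u,1),(u,-1)\}$, $\{(u,t),(w,t)\}$ for $t=\pm1$ and $\{u,w\}\in\Delta$, and $\{(u,1),(w,-1)\}$ for each edge oriented $u\to w$; its faces are the vertex sets whose projection to $V(\Delta)$ is a face of $\Delta$ and any two of whose elements form an edge. This is the simplicial refinement of $\Delta\times[-1,1]$ corresponding to $\ell$. -}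

module Defs where

open import Data.Nat using (ℕ)
open import Data.Fin using (Fin; _≟_)
open import Data.Bool using (Bool; true; false; _∨_; not)
open import Data.Product using (_×_; _,_; Σ)
open import Data.Sum using (_⊎_)
open import Data.Empty using (⊥)
open import Relation.Nullary using (¬_)
open import Relation.Nullary.Decidable using (⌊_⌋)
open import Relation.Binary.PropositionalEquality using (_≡_; _≢_)
open import Function using (_∘_)

VSet : Set → Set
VSet V = V → Bool

NonEmpty : {V : Set} → VSet V → Set
NonEmpty {V} F = Σ V (λ v → F v ≡ true)

_⊆ᵥ_ : {V : Set} → VSet V → VSet V → Set
G ⊆ᵥ F = ∀ v → G v ≡ true → F v ≡ true

⟦_⟧₁ : {n : ℕ} → Fin n → VSet (Fin n)
⟦ u ⟧₁ x = ⌊ x ≟ u ⌋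

⟦_,_⟧₂ : {n : ℕ} → Fin n → Fin n → VSet (Fin n)
⟦ u , w ⟧₂ x = ⌊ x ≟ u ⌋ ∨ ⌊ x ≟ w ⌋

⟦_,_,_⟧₃ : {n : ℕ} → Fin n → Fin n → Fin n → VSet (Fin n)
⟦ a , b , c ⟧₃ x = ⌊ x ≟ a ⌋ ∨ (⌊ x ≟ b ⌋ ∨ ⌊ x ≟ c ⌋)

-- A simplicial complex with vertex set Fin n: a family of faces
-- (subsets of Fin n) closed under taking subsets, in which every
-- singleton is a face (so the vertex set is all of Fin n).
record SimplicialComplex (n : ℕ) : Set₁ where
  field
    Face       : VSet (Fin n) → Set
    down-closed : ∀ {F G} → Face F → G ⊆ᵥ F → Face G
    vertex     : ∀ v → Face ⟦ v ⟧₁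
open SimplicialComplex public

-- σ is a free involution of the vertex set V, mapping faces to faces
-- and inducing a free involution on the non-empty faces.
-- (Since σ is an involution, the image σ(F) has characteristic function F ∘ σ.)
record IsCSInvolution {V : Set} (Face : VSet V → Set) (σ : V → V) : Set where
  field
    involutive   : ∀ v → σ (σ v) ≡ v
    free         : ∀ v → σ v ≢ v
    faces→faces  : ∀ F → Face F → Face (F ∘ σ)
    free-on-faces : ∀ F → Face F → NonEmpty F → ¬ (∀ v → F (σ v) ≡ F v)

CentrallySymmetric : {n : ℕ} → SimplicialComplex n → (Fin n → Fin n) → Set
CentrallySymmetric Δ σ = IsCSInvolution (Face Δ) σ

record Orientation {n : ℕ} (Δ : SimplicialComplex n) : Set₁ where
  field
    _⇒_       : Fin n → Fin n → Set
    on-edges  : ∀ {u w} → u ⇒ w → (u ≢ w) × Face Δ ⟦ u , w ⟧₂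
    total     : ∀ u w → u ≢ w → Face Δ ⟦ u , w ⟧₂ → (u ⇒ w) ⊎ (w ⇒ u)
    antisym   : ∀ {u w} → u ⇒ w → w ⇒ u → ⊥
open Orientation public

LocallyAcyclic : {n : ℕ} {Δ : SimplicialComplex n} → Orientation Δ → Set
LocallyAcyclic {Δ = Δ} ℓ =
  ∀ a b c → Face Δ ⟦ a , b , c ⟧₃ →
    _⇒_ ℓ a b → _⇒_ ℓ b c → _⇒_ ℓ c a → ⊥

-- Refinement (Δ × [-1,1])^ℓ on Fin n × Bool, with true ↔ 1, false ↔ -1.
-- Edge relation (symmetric) of the refinement, for distinct vertices.
RefEdge : {n : ℕ} {Δ : SimplicialComplex n} → Orientation Δ →
          Fin n × Bool → Fin n × Bool → Set
RefEdge {Δ = Δ} ℓ (u , true)  (w , true)  = Face Δ ⟦ u , w ⟧₂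
RefEdge {Δ = Δ} ℓ (u , false) (w , false) = Face Δ ⟦ u , w ⟧₂
RefEdge ℓ (u , true)  (w , false) = (u ≡ w) ⊎ (_⇒_ ℓ u w)
RefEdge ℓ (u , false) (w , true)  = (u ≡ w) ⊎ (_⇒_ ℓ w u)

proj : {n : ℕ} → VSet (Fin n × Bool) → VSet (Fin n)
proj F v = F (v , true) ∨ F (v , false)

RefFace : {n : ℕ} {Δ : SimplicialComplex n} → Orientation Δ →
          VSet (Fin n × Bool) → Set
RefFace {Δ = Δ} ℓ F =
  Face Δ (proj F) ×
  (∀ x y → F x ≡ true → F y ≡ true → x ≢ y → RefEdge ℓ x y)

liftInv : {n : ℕ} → (Fin n → Fin n) → Fin n × Bool → Fin n × Bool
liftInv σ (v , t) = (σ v , not t)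

-- If u → w, then {(u,1),(w,-1)} is an edge of the refinement. Its image under σ̃ is
-- {(σ w,1),(σ u,-1)}, again an edge, and as σ w ≠ σ u this forces σ w → σ u. Applying
-- the same to σ w → σ u and using σ² = id gives the converse.
module Submission where

open import Defs
open import Data.Fin using (Fin; _≟_)
open import Data.Bool using (Bool; true; false)
open import Data.Bool.Properties using (T-≡)
open import Data.Product using (_×_; _,_; proj₁; proj₂)
open import Data.Sum using (inj₁; inj₂)
open import Data.Empty using (⊥-elim)
open import Relation.Nullary.Decidable using (⌊_⌋; toWitness; fromWitness)
open import Relation.Binary.PropositionalEquality
open import Function using (_∘_)
open import Function.Bundles using (_⇔_; mk⇔; Equivalence)

≟-sound : ∀ {n} {a b : Fin n} → ⌊ a ≟ b ⌋ ≡ true → a ≡ b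
≟-sound a≟b = toWitness (Equivalence.from T-≡ a≟b)

≟-complete : ∀ {n} {a b : Fin n} → a ≡ b → ⌊ a ≟ b ⌋ ≡ true
≟-complete a≡b = Equivalence.to T-≡ (fromWitness a≡b)

involution-injective : ∀ {A : Set} {σ : A → A} → (∀ v → σ (σ v) ≡ v) →
  ∀ {u w} → σ u ≡ σ w → u ≡ w
involution-injective {σ = σ} σσ {u} {w} σu≡σw =
  trans (sym (σσ u)) (trans (cong σ σu≡σw) (σσ w))

crossEdge : ∀ {n} → Fin n → Fin n → VSet (Fin n × Bool)
crossEdge u w (x , true)  = ⌊ x ≟ u ⌋
crossEdge u w (x , false) = ⌊ x ≟ w ⌋

module _ {n} {Δ : SimplicialComplex n} (ℓ : Orientation Δ) where

  crossEdge-face : ∀ {u w} → _⇒_ ℓ u w → RefFace ℓ (crossEdge u w)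
  crossEdge-face {u} {w} u⇒w = proj₂ (on-edges ℓ u⇒w) , pairwise
    where
    pairwise : ∀ x y → crossEdge u w x ≡ true → crossEdge u w y ≡ true →
      x ≢ y → RefEdge ℓ x y
    pairwise (a , true) (b , true) a∈ b∈ x≢y =
      ⊥-elim (x≢y (cong (_, true) (trans (≟-sound a∈) (sym (≟-sound b∈)))))
    pairwise (a , false) (b , false) a∈ b∈ x≢y =
      ⊥-elim (x≢y (cong (_, false) (trans (≟-sound a∈) (sym (≟-sound b∈)))))
    pairwise (a , true) (b , false) a∈ b∈ _
      rewrite ≟-sound a∈ | ≟-sound b∈ = inj₂ u⇒w
    pairwise (a , false) (b , true) a∈ b∈ _
      rewrite ≟-sound a∈ | ≟-sound b∈ = inj₂ u⇒w

  ⇒-reversed : {σ : Fin n → Fin n} → (∀ v → σ (σ v) ≡ v) →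
    (∀ F → RefFace ℓ F → RefFace ℓ (F ∘ liftInv σ)) →
    ∀ {u w} → _⇒_ ℓ u w → _⇒_ ℓ (σ w) (σ u)
  ⇒-reversed {σ} σσ faces→faces {u} {w} u⇒w
    with proj₂ (faces→faces _ (crossEdge-face u⇒w)) (σ w , true) (σ u , false)
                (≟-complete (σσ w)) (≟-complete (σσ u)) (λ ())
  ... | inj₂ σw⇒σu = σw⇒σu
  ... | inj₁ σw≡σu =
    ⊥-elim (proj₁ (on-edges ℓ u⇒w) (involution-injective σσ (sym σw≡σu)))

lemma3p8 : ∀ {n} (Δ : SimplicialComplex n) (σ : Fin n → Fin n) (ℓ : Orientation Δ) →
    CentrallySymmetric Δ σ → LocallyAcyclic ℓ →
    IsCSInvolution (RefFace ℓ) (liftInv σ) →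
    ∀ v w → v ≢ w → Face Δ ⟦ v , w ⟧₂ →
    (_⇒_ ℓ v w ⇔ _⇒_ ℓ (σ w) (σ v))
lemma3p8 Δ σ ℓ cs _ ref v w _ _ =
  mk⇔ reverse (subst₂ (_⇒_ ℓ) (σσ v) (σσ w) ∘ reverse)
  where
  σσ : ∀ u → σ (σ u) ≡ u
  σσ = IsCSInvolution.involutive cs

  reverse : ∀ {u w} → _⇒_ ℓ u w → _⇒_ ℓ (σ w) (σ u)
  reverse = ⇒-reversed ℓ σσ (IsCSInvolution.faces→faces ref)
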